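{- For all integers $n$, $r$ and $k$ with $n\ge r\ge 1$, $$\sum_{j=r}^n\left\{{n\atop j}\right\}_r c_j^{(k)}=\sum_{\ell=1}^{r}\frac{(-1)^{r-\ell}}{(n-r+\ell+1)^k}\left[{r\atop \ell}\right].$$
   Context: For an integer $k$, the poly-Cauchy numbers (of the first kind) $c_n^{(k)}$ are defined by $\mathrm{Lif}_k(\log(1+x))=\sum_{n\ge0}c_n^{(k)}x^n/n!$, where $\mathrm{Lif}_k(z)=\sum_{m\ge0}\frac{z^m}{m!(m+1)^k}$. $\left[{n\atop m}\right]$ denotes the unsigned Stirling number of the first kind, defined by $x(x+1)\cdots(x+n-1)=\sum_{m}\left[{n\atop m}\right]x^m$. For $r\ge 0$, the $r$-Stirling number of the second kind $\left\{{n\atop m}\right\}_r$ is the number of ways to partition $\{1,\dots,n\}$ into $m$ nonempty disjoint blocks such that $1,\dots,r$ lie in distinct blocks; equivalently $\left\{{n\atop m}\right\}_r=0$ for $n<r$, $\left\{{r\atop m}\right\}_r=\delta_{m,r}$, and $\left\{{n\atop m}\right\}_r=m\left\{{n-1\atop m}\right\}_r+\left\{{n-1\atop m-1}\right\}_r$ for $n>r$. -}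

module Defs where

open import Data.Nat as ℕ using (ℕ; zero; suc; _∸_; _≡ᵇ_; _<ᵇ_)
open import Data.Nat.Properties using (_!≢0)
open import Data.Bool using (if_then_else_)
open import Data.Integer as ℤ using (ℤ; +_; -[1+_])
open import Data.Rational using (ℚ; 0ℚ; 1ℚ; _+_; _*_; -_; _/_)

sumBelow : ℕ → (ℕ → ℚ) → ℚ
sumBelow zero    f = 0ℚ
sumBelow (suc n) f = sumBelow n f + f n

-- Σ_{i=a}^{b} f i  (empty if b < a)
sumFromTo : ℕ → ℕ → (ℕ → ℚ) → ℚ
sumFromTo a b f = sumBelow (suc b ∸ a) (λ i → f (a ℕ.+ i))

_^ℚ_ : ℚ → ℕ → ℚ
p ^ℚ zero  = 1ℚ
p ^ℚ suc n = p * (p ^ℚ n)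

ℕ→ℚ : ℕ → ℚ
ℕ→ℚ n = (+ n) / 1

-- invPow a k = 1 / (a+1)^k  for an integer exponent k
invPow : ℕ → ℤ → ℚ
invPow a (+ j)      = ((+ 1) / suc a) ^ℚ j
invPow a -[1+ j ]   = ℕ→ℚ (suc a) ^ℚ suc j

Series : Set
Series = ℕ → ℚ

_⊛_ : Series → Series → Series
(f ⊛ g) n = sumBelow (suc n) (λ i → f i * g (n ∸ i))

_^S_ : Series → ℕ → Series
f ^S zero = λ { zero → 1ℚ ; (suc _) → 0ℚ }
f ^S suc m = f ⊛ (f ^S m)

log1p : Series
log1p zero    = 0ℚ
log1p (suc n) = ((- 1ℚ) ^ℚ n) * ((+ 1) / suc n)

-- Lif_k(z) = Σ_m z^m / (m! (m+1)^k); its m-th coefficient: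
lifCoeff : ℤ → ℕ → ℚ
lifCoeff k m = (_/_ (+ 1) (m ℕ.!) {{m !≢0}}) * invPow m k

-- coefficient of x^n in Lif_k(log(1+x)).  Since log(1+x) has zero constant
-- term, only the terms m = 0..n of Lif_k contribute to x^n.
LifLogCoeff : ℤ → ℕ → ℚ
LifLogCoeff k n = sumBelow (suc n) (λ m → lifCoeff k m * (log1p ^S m) n)

-- poly-Cauchy number c_n^{(k)} = n! [x^n] Lif_k(log(1+x))
polyCauchy : ℕ → ℤ → ℚ
polyCauchy n k = ℕ→ℚ (n ℕ.!) * LifLogCoeff k n

-- unsigned Stirling numbers of the first kind:
-- coefficients of x(x+1)...(x+n-1), i.e. [n+1,m] = n [n,m] + [n,m-1]
stirling1 : ℕ → ℕ → ℕ
stirling1 zero    zero    = 1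
stirling1 zero    (suc m) = 0
stirling1 (suc n) zero    = 0
stirling1 (suc n) (suc m) = n ℕ.* stirling1 n (suc m) ℕ.+ stirling1 n m

-- r-Stirling numbers of the second kind, by the recurrence in the paper:
-- {n,m}_r = 0 for n < r, {r,m}_r = δ_{m,r},
-- {n,m}_r = m {n-1,m}_r + {n-1,m-1}_r for n > r.
rStirling2 : ℕ → ℕ → ℕ → ℕ
rStirling2 r zero m = if r ≡ᵇ 0 then (if m ≡ᵇ 0 then 1 else 0) else 0
rStirling2 r (suc n) m =
  if suc n <ᵇ r then 0
  else if suc n ≡ᵇ r then (if m ≡ᵇ r then 1 else 0)
  else rec m
  where
  rec : ℕ → ℕ
  rec zero    = 0 ℕ.* rStirling2 r n zero
  rec (suc j) = suc j ℕ.* rStirling2 r n (suc j) ℕ.+ rStirling2 r n j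

{-# OPTIONS --safe #-}
module Submission where

-- Writing L = log(1 + x), the powers of L satisfy (1 + x) (L^m)′ = m L^(m−1).  Comparing
-- coefficients shows that n! [x^n] L^m / m! obeys the recurrence of the signed Stirling
-- numbers s(n,m) = (−1)^(n−m) [n,m], hence c_j^(k) = Σ_m s(j,m) / (m+1)^k.  Substituting this
-- and exchanging the two sums reduces the theorem to the orthogonality relation
-- Σ_j {r+d, j}_r s(j,m) = s(r, m−d), proved by induction on d = n − r: a summation by parts
-- moves the recurrence of the r-Stirling numbers onto s, where it meets
-- j s(j,m+1) + s(j+1,m+1) = s(j,m).

open import Defs
open import Data.Bool using (true; false; if_then_else_)
open import Data.Empty using (⊥-elim)
open import Data.Integer as ℤ using (ℤ; +_)
import Data.Integer.Properties as ℤₚ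
open import Data.Nat as ℕ using (ℕ; zero; suc; _≤_; _<_; _∸_; s≤s; z≤n; _!; _≡ᵇ_; _<ᵇ_)
import Data.Nat.Properties as ℕₚ
open import Data.Nat.Properties using (_!≢0)
open import Data.Nat.Coprimality using (1-coprimeTo) renaming (sym to coprime-sym)
open import Data.Rational using (ℚ; mkℚ; 0ℚ; 1ℚ; _+_; _*_; _-_; -_; _/_)
import Data.Rational.Properties as ℚₚ
open import Data.Rational.Solver using (module +-*-Solver)
open import Function using (_∘′_)
open import Relation.Binary.PropositionalEquality
open import Relation.Nullary using (¬_; yes; no)
open import Algebra.Bundles using (CommutativeMonoid)
open import Algebra.Properties.CommutativeSemigroup
  (CommutativeMonoid.commutativeSemigroup ℚₚ.*-1-commutativeMonoid) using (x∙yz≈y∙xz)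
open +-*-Solver
open ≡-Reasoning

ℕ→ℚ≡mkℚ : ∀ n → ℕ→ℚ n ≡ mkℚ (+ n) 0 (coprime-sym (1-coprimeTo n))
ℕ→ℚ≡mkℚ n = ℚₚ.↥p/↧p≡p (mkℚ (+ n) 0 (coprime-sym (1-coprimeTo n)))

ℕ→ℚ-+ : ∀ a b → ℕ→ℚ (a ℕ.+ b) ≡ ℕ→ℚ a + ℕ→ℚ b
ℕ→ℚ-+ a b rewrite ℕ→ℚ≡mkℚ a | ℕ→ℚ≡mkℚ b =
  cong (λ z → z / 1) (sym (cong₂ ℤ._+_ (ℤₚ.*-identityʳ (+ a)) (ℤₚ.*-identityʳ (+ b))))

ℕ→ℚ-* : ∀ a b → ℕ→ℚ (a ℕ.* b) ≡ ℕ→ℚ a * ℕ→ℚ b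
ℕ→ℚ-* a b rewrite ℕ→ℚ≡mkℚ a | ℕ→ℚ≡mkℚ b = cong (λ z → z / 1) (ℤₚ.pos-* a b)

1/n*n≡1 : ∀ n .{{_ : ℕ.NonZero n}} → (+ 1 / n) * ℕ→ℚ n ≡ 1ℚ
1/n*n≡1 (suc n) rewrite ℕ→ℚ≡mkℚ (suc n) =
  trans (cong (_* q) (ℚₚ.↥p/↧p≡p (mkℚ (+ 1) n (1-coprimeTo (suc n))))) (ℚₚ.*-inverseˡ q)
  where
  q : ℚ
  q = mkℚ (+ suc n) 0 (coprime-sym (1-coprimeTo (suc n)))

sumBelow-cong : ∀ n {f g : ℕ → ℚ} → (∀ i → i < n → f i ≡ g i) → sumBelow n f ≡ sumBelow n g
sumBelow-cong zero    f≡g = refl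
sumBelow-cong (suc n) f≡g =
  cong₂ _+_ (sumBelow-cong n (λ i i<n → f≡g i (ℕₚ.m<n⇒m<1+n i<n))) (f≡g n ℕₚ.≤-refl)

sumBelow-+ : ∀ n (f g : ℕ → ℚ) → sumBelow n (λ i → f i + g i) ≡ sumBelow n f + sumBelow n g
sumBelow-+ zero    f g = refl
sumBelow-+ (suc n) f g rewrite sumBelow-+ n f g =
  solve 4 (λ a b c d → (a :+ b) :+ (c :+ d) := (a :+ c) :+ (b :+ d)) refl
    (sumBelow n f) (sumBelow n g) (f n) (g n)

*-distribˡ-sumBelow : ∀ n c (f : ℕ → ℚ) → c * sumBelow n f ≡ sumBelow n (λ i → c * f i)
*-distribˡ-sumBelow zero    c f = ℚₚ.*-zeroʳ c
*-distribˡ-sumBelow (suc n) c f rewrite sym (*-distribˡ-sumBelow n c f) =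
  ℚₚ.*-distribˡ-+ c (sumBelow n f) (f n)

sumBelow-zero : ∀ n {f : ℕ → ℚ} → (∀ i → i < n → f i ≡ 0ℚ) → sumBelow n f ≡ 0ℚ
sumBelow-zero zero    f≡0 = refl
sumBelow-zero (suc n) f≡0 =
  cong₂ _+_ (sumBelow-zero n (λ i i<n → f≡0 i (ℕₚ.m<n⇒m<1+n i<n))) (f≡0 n ℕₚ.≤-refl)

sumBelow-sucˡ : ∀ n (f : ℕ → ℚ) → sumBelow (suc n) f ≡ f 0 + sumBelow n (λ i → f (suc i))
sumBelow-sucˡ zero    f = trans (ℚₚ.+-identityˡ (f 0)) (sym (ℚₚ.+-identityʳ (f 0)))
sumBelow-sucˡ (suc n) f rewrite sumBelow-sucˡ n f = ℚₚ.+-assoc (f 0) _ _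

sumBelow-++ : ∀ a b (f : ℕ → ℚ) →
  sumBelow (a ℕ.+ b) f ≡ sumBelow a f + sumBelow b (λ i → f (a ℕ.+ i))
sumBelow-++ a zero    f rewrite ℕₚ.+-identityʳ a = sym (ℚₚ.+-identityʳ _)
sumBelow-++ a (suc b) f rewrite ℕₚ.+-suc a b | sumBelow-++ a b f = ℚₚ.+-assoc (sumBelow a f) _ _

sumBelow-drop-zero-prefix : ∀ a b {f : ℕ → ℚ} → (∀ i → i < a → f i ≡ 0ℚ) →
  sumBelow (a ℕ.+ b) f ≡ sumBelow b (λ i → f (a ℕ.+ i))
sumBelow-drop-zero-prefix a b {f} prefix≡0 = begin
  sumBelow (a ℕ.+ b) f                           ≡⟨ sumBelow-++ a b f ⟩
  sumBelow a f + sumBelow b (λ i → f (a ℕ.+ i))  ≡⟨ cong (_+ sumBelow b (λ i → f (a ℕ.+ i))) (sumBelow-zero a prefix≡0) ⟩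
  0ℚ + sumBelow b (λ i → f (a ℕ.+ i))            ≡⟨ ℚₚ.+-identityˡ _ ⟩
  sumBelow b (λ i → f (a ℕ.+ i))                 ∎

sumBelow-extend : ∀ {a b} (f : ℕ → ℚ) → a ≤ b → (∀ i → a ≤ i → f i ≡ 0ℚ) →
  sumBelow a f ≡ sumBelow b f
sumBelow-extend {a} {b} f a≤b tail≡0 = begin
  sumBelow a f                                         ≡⟨ sym (ℚₚ.+-identityʳ _) ⟩
  sumBelow a f + 0ℚ                                    ≡⟨ cong (λ t → sumBelow a f + t) (sym tail-sum≡0) ⟩
  sumBelow a f + sumBelow (b ∸ a) (λ i → f (a ℕ.+ i))  ≡⟨ sym (sumBelow-++ a (b ∸ a) f) ⟩
  sumBelow (a ℕ.+ (b ∸ a)) f                           ≡⟨ cong (λ t → sumBelow t f) (ℕₚ.m+[n∸m]≡n a≤b) ⟩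
  sumBelow b f                                         ∎
  where
  tail-sum≡0 : sumBelow (b ∸ a) (λ i → f (a ℕ.+ i)) ≡ 0ℚ
  tail-sum≡0 = sumBelow-zero (b ∸ a) (λ i _ → tail≡0 (a ℕ.+ i) (ℕₚ.m≤m+n a i))

sumFromTo-vanishing-below : ∀ {a b} (f : ℕ → ℚ) → a ≤ suc b → (∀ j → j < a → f j ≡ 0ℚ) →
  sumFromTo a b f ≡ sumBelow (suc b) f
sumFromTo-vanishing-below {a} {b} f a≤1+b below≡0 = begin
  sumBelow (suc b ∸ a) (λ i → f (a ℕ.+ i))  ≡⟨ sym (sumBelow-drop-zero-prefix a (suc b ∸ a) below≡0) ⟩
  sumBelow (a ℕ.+ (suc b ∸ a)) f            ≡⟨ cong (λ t → sumBelow t f) (ℕₚ.m+[n∸m]≡n a≤1+b) ⟩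
  sumBelow (suc b) f                        ∎

sumBelow-shift : ∀ n (h : ℕ → ℚ) → h 0 ≡ 0ℚ → h n ≡ 0ℚ →
  sumBelow n (λ j → h (suc j)) ≡ sumBelow n h
sumBelow-shift n h h0≡0 hn≡0 = begin
  sumBelow n (λ j → h (suc j))        ≡⟨ sym (ℚₚ.+-identityˡ _) ⟩
  0ℚ + sumBelow n (λ j → h (suc j))   ≡⟨ cong (_+ sumBelow n (λ j → h (suc j))) (sym h0≡0) ⟩
  h 0 + sumBelow n (λ j → h (suc j))  ≡⟨ sym (sumBelow-sucˡ n h) ⟩
  sumBelow n h + h n                  ≡⟨ cong (λ t → sumBelow n h + t) hn≡0 ⟩
  sumBelow n h + 0ℚ                   ≡⟨ ℚₚ.+-identityʳ _ ⟩
  sumBelow n h                        ∎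

sumBelow-comm : ∀ n m (f : ℕ → ℕ → ℚ) →
  sumBelow n (λ i → sumBelow m (f i)) ≡ sumBelow m (λ j → sumBelow n (λ i → f i j))
sumBelow-comm zero    m f = sym (sumBelow-zero m (λ _ _ → refl))
sumBelow-comm (suc n) m f rewrite sumBelow-comm n m f = sym (sumBelow-+ m _ _)

sumBelow-interchange : ∀ n m (a b : ℕ → ℚ) (c : ℕ → ℕ → ℚ) →
  sumBelow n (λ i → a i * sumBelow m (λ j → b j * c i j))
  ≡ sumBelow m (λ j → b j * sumBelow n (λ i → a i * c i j))
sumBelow-interchange n m a b c = begin
  sumBelow n (λ i → a i * sumBelow m (λ j → b j * c i j))
    ≡⟨ sumBelow-cong n (λ i _ → *-distribˡ-sumBelow m (a i) _) ⟩
  sumBelow n (λ i → sumBelow m (λ j → a i * (b j * c i j)))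
    ≡⟨ sumBelow-comm n m _ ⟩
  sumBelow m (λ j → sumBelow n (λ i → a i * (b j * c i j)))
    ≡⟨ sumBelow-cong m (λ j _ → sumBelow-cong n (λ i _ → x∙yz≈y∙xz (a i) (b j) (c i j))) ⟩
  sumBelow m (λ j → sumBelow n (λ i → b j * (a i * c i j)))
    ≡⟨ sumBelow-cong m (λ j _ → sym (*-distribˡ-sumBelow n (b j) _)) ⟩
  sumBelow m (λ j → b j * sumBelow n (λ i → a i * c i j))
    ∎

stirling1-vanish : ∀ {n m} → n < m → stirling1 n m ≡ 0
stirling1-vanish {zero}  {suc m} _ = refl
stirling1-vanish {suc n} {suc m} (s≤s n<m)
  rewrite stirling1-vanish {n} {suc m} (ℕₚ.m<n⇒m<1+n n<m) | stirling1-vanish {n} {m} n<m =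
  trans (ℕₚ.+-identityʳ (n ℕ.* 0)) (ℕₚ.*-zeroʳ n)

signedStirling1 : ℕ → ℕ → ℚ
signedStirling1 n m = (- 1ℚ) ^ℚ (n ∸ m) * ℕ→ℚ (stirling1 n m)

signedStirling1-vanish : ∀ {n m} → n < m → signedStirling1 n m ≡ 0ℚ
signedStirling1-vanish {n} {m} n<m =
  trans (cong (λ t → (- 1ℚ) ^ℚ (n ∸ m) * ℕ→ℚ t) (stirling1-vanish n<m)) (ℚₚ.*-zeroʳ ((- 1ℚ) ^ℚ (n ∸ m)))

signedStirling1-suc-zero : ∀ n → signedStirling1 (suc n) 0 ≡ 0ℚ
signedStirling1-suc-zero n = ℚₚ.*-zeroʳ ((- 1ℚ) ^ℚ suc n)

-1^suc : ∀ e → (- 1ℚ) ^ℚ suc e ≡ - ((- 1ℚ) ^ℚ e)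
-1^suc e = trans (sym (ℚₚ.neg-distribˡ-* 1ℚ ((- 1ℚ) ^ℚ e))) (cong -_ (ℚₚ.*-identityˡ _))

signedStirling1-rec : ∀ n m →
  ℕ→ℚ n * signedStirling1 n (suc m) + signedStirling1 (suc n) (suc m) ≡ signedStirling1 n m
signedStirling1-rec n m with m ℕ.<? n
... | yes m<n = begin
  x * (ε * A) + ε′ * ℕ→ℚ (n ℕ.* a ℕ.+ b)
    ≡⟨ cong₂ (λ u v → x * (ε * A) + u * v) ε′≡-ε
             (trans (ℕ→ℚ-+ (n ℕ.* a) b) (cong (_+ B) (ℕ→ℚ-* n a))) ⟩
  x * (ε * A) + (- ε) * (x * A + B)
    ≡⟨ solve 4 (λ x ε A B → x :* (ε :* A) :+ (:- ε) :* (x :* A :+ B) := (:- ε) :* B) refl x ε A B ⟩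
  (- ε) * B
    ≡⟨ cong (_* B) (sym ε′≡-ε) ⟩
  ε′ * B
    ∎
  where
  a = stirling1 n (suc m)
  b = stirling1 n m
  x = ℕ→ℚ n
  A = ℕ→ℚ a
  B = ℕ→ℚ b
  ε = (- 1ℚ) ^ℚ (n ∸ suc m)
  ε′ = (- 1ℚ) ^ℚ (n ∸ m)
  ε′≡-ε : ε′ ≡ - ε
  ε′≡-ε = trans (cong ((- 1ℚ) ^ℚ_) (ℕₚ.+-∸-assoc 1 m<n)) (-1^suc (n ∸ suc m))
... | no m≮n = begin
  x * (ε * ℕ→ℚ a) + ε′ * ℕ→ℚ (n ℕ.* a ℕ.+ b)
    ≡⟨ cong₂ (λ u v → x * (ε * ℕ→ℚ u) + ε′ * ℕ→ℚ (n ℕ.* u ℕ.+ b)) a≡0 a≡0 ⟩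
  x * (ε * 0ℚ) + ε′ * ℕ→ℚ (n ℕ.* 0 ℕ.+ b)
    ≡⟨ cong₂ (λ u v → x * u + ε′ * ℕ→ℚ (v ℕ.+ b)) (ℚₚ.*-zeroʳ ε) (ℕₚ.*-zeroʳ n) ⟩
  x * 0ℚ + ε′ * ℕ→ℚ b
    ≡⟨ cong (_+ ε′ * ℕ→ℚ b) (ℚₚ.*-zeroʳ x) ⟩
  0ℚ + ε′ * ℕ→ℚ b
    ≡⟨ ℚₚ.+-identityˡ _ ⟩
  ε′ * ℕ→ℚ b
    ∎
  where
  a = stirling1 n (suc m)
  b = stirling1 n m
  x = ℕ→ℚ n
  ε = (- 1ℚ) ^ℚ (n ∸ suc m)
  ε′ = (- 1ℚ) ^ℚ (n ∸ m)
  a≡0 : a ≡ 0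
  a≡0 = stirling1-vanish (s≤s (ℕₚ.≮⇒≥ m≮n))

signedStirling1-rec-zero : ∀ n → ℕ→ℚ n * signedStirling1 n 0 + signedStirling1 (suc n) 0 ≡ 0ℚ
signedStirling1-rec-zero zero    = refl
signedStirling1-rec-zero (suc n) =
  trans (cong₂ _+_ (trans (cong (ℕ→ℚ (suc n) *_) (signedStirling1-suc-zero n)) (ℚₚ.*-zeroʳ (ℕ→ℚ (suc n))))
                   (signedStirling1-suc-zero (suc n)))
        (ℚₚ.+-identityʳ 0ℚ)

xD : Series → Series
xD f n = ℕ→ℚ n * f n

-- D⁺ f = (1 + x) f′
D⁺ : Series → Series
D⁺ f n = xD f (suc n) + xD f n

𝟙 : Series
𝟙 zero    = 1ℚ
𝟙 (suc _) = 0ℚ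

⊛-identityˡ : ∀ g n → (𝟙 ⊛ g) n ≡ g n
⊛-identityˡ g n = begin
  (𝟙 ⊛ g) n                                        ≡⟨ sumBelow-sucˡ n _ ⟩
  1ℚ * g n + sumBelow n (λ i → 0ℚ * g (n ∸ suc i))  ≡⟨ cong₂ _+_ (ℚₚ.*-identityˡ (g n)) tail≡0 ⟩
  g n + 0ℚ                                         ≡⟨ ℚₚ.+-identityʳ (g n) ⟩
  g n                                              ∎
  where
  tail≡0 : sumBelow n (λ i → 0ℚ * g (n ∸ suc i)) ≡ 0ℚ
  tail≡0 = sumBelow-zero n (λ i _ → ℚₚ.*-zeroˡ (g (n ∸ suc i)))

⊛-scaleʳ : ∀ f g c n → (f ⊛ (λ i → c * g i)) n ≡ c * (f ⊛ g) n
⊛-scaleʳ f g c n =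
  trans (sumBelow-cong (suc n) (λ i _ → x∙yz≈y∙xz (f i) c (g (n ∸ i))))
        (sym (*-distribˡ-sumBelow (suc n) c _))

⊛-sucˡ : ∀ a g n → a 0 ≡ 0ℚ → (a ⊛ g) (suc n) ≡ sumBelow (suc n) (λ i → a (suc i) * g (n ∸ i))
⊛-sucˡ a g n a0≡0 = begin
  (a ⊛ g) (suc n)                        ≡⟨ sumBelow-sucˡ (suc n) _ ⟩
  a 0 * g (suc n) + S                    ≡⟨ cong (λ t → t * g (suc n) + S) a0≡0 ⟩
  0ℚ * g (suc n) + S                     ≡⟨ cong (_+ S) (ℚₚ.*-zeroˡ (g (suc n))) ⟩
  0ℚ + S                                 ≡⟨ ℚₚ.+-identityˡ S ⟩
  S                                      ∎
  where
  S = sumBelow (suc n) (λ i → a (suc i) * g (n ∸ i))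

⊛-sucʳ : ∀ f h n → h 0 ≡ 0ℚ → (f ⊛ h) (suc n) ≡ sumBelow (suc n) (λ i → f i * h (suc (n ∸ i)))
⊛-sucʳ f h n h0≡0 = begin
  S + f (suc n) * h (n ∸ n)       ≡⟨ cong (λ t → S + f (suc n) * h t) (ℕₚ.n∸n≡0 n) ⟩
  S + f (suc n) * h 0             ≡⟨ cong (λ t → S + f (suc n) * t) h0≡0 ⟩
  S + f (suc n) * 0ℚ              ≡⟨ cong (λ t → S + t) (ℚₚ.*-zeroʳ (f (suc n))) ⟩
  S + 0ℚ                          ≡⟨ ℚₚ.+-identityʳ S ⟩
  S                               ≡⟨ sumBelow-cong (suc n) suc∸≡suc[∸] ⟩
  sumBelow (suc n) (λ i → f i * h (suc (n ∸ i))) ∎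
  where
  S = sumBelow (suc n) (λ i → f i * h (suc n ∸ i))
  suc∸≡suc[∸] : ∀ i → i < suc n → f i * h (suc n ∸ i) ≡ f i * h (suc (n ∸ i))
  suc∸≡suc[∸] i (s≤s i≤n) = cong (λ t → f i * h t) (ℕₚ.+-∸-assoc 1 i≤n)

xD-⊛ : ∀ f g n → xD (f ⊛ g) n ≡ (xD f ⊛ g) n + (f ⊛ xD g) n
xD-⊛ f g n = begin
  ℕ→ℚ n * (f ⊛ g) n
    ≡⟨ *-distribˡ-sumBelow (suc n) (ℕ→ℚ n) _ ⟩
  sumBelow (suc n) (λ i → ℕ→ℚ n * (f i * g (n ∸ i)))
    ≡⟨ sumBelow-cong (suc n) leibniz ⟩
  sumBelow (suc n) (λ i → xD f i * g (n ∸ i) + f i * xD g (n ∸ i))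
    ≡⟨ sumBelow-+ (suc n) _ _ ⟩
  (xD f ⊛ g) n + (f ⊛ xD g) n
    ∎
  where
  leibniz : ∀ i → i < suc n → ℕ→ℚ n * (f i * g (n ∸ i)) ≡ xD f i * g (n ∸ i) + f i * xD g (n ∸ i)
  leibniz i (s≤s i≤n) = begin
    ℕ→ℚ n * (f i * g (n ∸ i))
      ≡⟨ cong (λ t → ℕ→ℚ t * (f i * g (n ∸ i))) (sym (ℕₚ.m+[n∸m]≡n i≤n)) ⟩
    ℕ→ℚ (i ℕ.+ (n ∸ i)) * (f i * g (n ∸ i))
      ≡⟨ cong (_* (f i * g (n ∸ i))) (ℕ→ℚ-+ i (n ∸ i)) ⟩
    (ℕ→ℚ i + ℕ→ℚ (n ∸ i)) * (f i * g (n ∸ i))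
      ≡⟨ solve 4 (λ a b x y → (a :+ b) :* (x :* y) := (a :* x) :* y :+ x :* (b :* y)) refl
           (ℕ→ℚ i) (ℕ→ℚ (n ∸ i)) (f i) (g (n ∸ i)) ⟩
    xD f i * g (n ∸ i) + f i * xD g (n ∸ i)
      ∎

D⁺-⊛ : ∀ f g n → D⁺ (f ⊛ g) n ≡ (D⁺ f ⊛ g) n + (f ⊛ D⁺ g) n
D⁺-⊛ f g n = begin
  xD (f ⊛ g) (suc n) + xD (f ⊛ g) n
    ≡⟨ cong₂ _+_ (xD-⊛ f g (suc n)) (xD-⊛ f g n) ⟩
  ((xD f ⊛ g) (suc n) + (f ⊛ xD g) (suc n)) + ((xD f ⊛ g) n + (f ⊛ xD g) n)
    ≡⟨ solve 4 (λ a b c d → (a :+ b) :+ (c :+ d) := (a :+ c) :+ (b :+ d)) refl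
         ((xD f ⊛ g) (suc n)) ((f ⊛ xD g) (suc n)) ((xD f ⊛ g) n) ((f ⊛ xD g) n) ⟩
  ((xD f ⊛ g) (suc n) + (xD f ⊛ g) n) + ((f ⊛ xD g) (suc n) + (f ⊛ xD g) n)
    ≡⟨ cong₂ (λ u v → (u + (xD f ⊛ g) n) + (v + (f ⊛ xD g) n))
         (⊛-sucˡ (xD f) g n (ℚₚ.*-zeroˡ (f 0))) (⊛-sucʳ f (xD g) n (ℚₚ.*-zeroˡ (g 0))) ⟩
  (L₁ + (xD f ⊛ g) n) + (R₁ + (f ⊛ xD g) n)
    ≡⟨ cong₂ _+_ (sym (sumBelow-+ (suc n) _ _)) (sym (sumBelow-+ (suc n) _ _)) ⟩
  sumBelow (suc n) (λ i → xD f (suc i) * g (n ∸ i) + xD f i * g (n ∸ i))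
    + sumBelow (suc n) (λ i → f i * xD g (suc (n ∸ i)) + f i * xD g (n ∸ i))
    ≡⟨ cong₂ _+_
         (sumBelow-cong (suc n) (λ i _ → sym (ℚₚ.*-distribʳ-+ (g (n ∸ i)) (xD f (suc i)) (xD f i))))
         (sumBelow-cong (suc n) (λ i _ → sym (ℚₚ.*-distribˡ-+ (f i) (xD g (suc (n ∸ i))) (xD g (n ∸ i))))) ⟩
  (D⁺ f ⊛ g) n + (f ⊛ D⁺ g) n
    ∎
  where
  L₁ = sumBelow (suc n) (λ i → xD f (suc i) * g (n ∸ i))
  R₁ = sumBelow (suc n) (λ i → f i * xD g (suc (n ∸ i)))

xD-log1p-suc : ∀ i → xD log1p (suc i) ≡ (- 1ℚ) ^ℚ i
xD-log1p-suc i = begin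
  ℕ→ℚ (suc i) * ((- 1ℚ) ^ℚ i * (+ 1 / suc i))
    ≡⟨ solve 3 (λ a b c → a :* (b :* c) := b :* (c :* a)) refl (ℕ→ℚ (suc i)) ((- 1ℚ) ^ℚ i) (+ 1 / suc i) ⟩
  (- 1ℚ) ^ℚ i * ((+ 1 / suc i) * ℕ→ℚ (suc i))
    ≡⟨ cong ((- 1ℚ) ^ℚ i *_) (1/n*n≡1 (suc i)) ⟩
  (- 1ℚ) ^ℚ i * 1ℚ
    ≡⟨ ℚₚ.*-identityʳ _ ⟩
  (- 1ℚ) ^ℚ i
    ∎

D⁺-log1p : ∀ n → D⁺ log1p n ≡ 𝟙 n
D⁺-log1p zero    = trans (cong₂ _+_ (xD-log1p-suc 0) (ℚₚ.*-zeroˡ (log1p 0))) (ℚₚ.+-identityʳ 1ℚ)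
D⁺-log1p (suc n) =
  trans (cong₂ _+_ (trans (xD-log1p-suc (suc n)) (-1^suc n)) (xD-log1p-suc n))
        (ℚₚ.+-inverseˡ ((- 1ℚ) ^ℚ n))

D⁺-log1p^S : ∀ m n → D⁺ (log1p ^S m) n ≡ ℕ→ℚ m * (log1p ^S (m ∸ 1)) n
D⁺-log1p^S zero zero    = refl
D⁺-log1p^S zero (suc n) =
  cong₂ _+_ (ℚₚ.*-zeroʳ (ℕ→ℚ (suc (suc n)))) (ℚₚ.*-zeroʳ (ℕ→ℚ (suc n)))
D⁺-log1p^S (suc m) n = begin
  D⁺ (log1p ⊛ (log1p ^S m)) n
    ≡⟨ D⁺-⊛ log1p (log1p ^S m) n ⟩
  (D⁺ log1p ⊛ (log1p ^S m)) n + (log1p ⊛ D⁺ (log1p ^S m)) n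
    ≡⟨ cong₂ _+_ unit-term recursive-term ⟩
  (log1p ^S m) n + ℕ→ℚ m * (log1p ^S m) n
    ≡⟨ solve 2 (λ x c → x :+ c :* x := (con 1ℚ :+ c) :* x) refl ((log1p ^S m) n) (ℕ→ℚ m) ⟩
  (1ℚ + ℕ→ℚ m) * (log1p ^S m) n
    ≡⟨ cong (_* (log1p ^S m) n) (sym (ℕ→ℚ-+ 1 m)) ⟩
  ℕ→ℚ (suc m) * (log1p ^S m) n
    ∎
  where
  unit-term : (D⁺ log1p ⊛ (log1p ^S m)) n ≡ (log1p ^S m) n
  unit-term = trans (sumBelow-cong (suc n) (λ i _ → cong (_* (log1p ^S m) (n ∸ i)) (D⁺-log1p i)))
                       (⊛-identityˡ (log1p ^S m) n)
  m*log1p^S-pred : ∀ m → ℕ→ℚ m * (log1p ⊛ (log1p ^S (m ∸ 1))) n ≡ ℕ→ℚ m * (log1p ^S m) n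
  m*log1p^S-pred zero    = trans (ℚₚ.*-zeroˡ ((log1p ⊛ (log1p ^S 0)) n)) (sym (ℚₚ.*-zeroˡ ((log1p ^S 0) n)))
  m*log1p^S-pred (suc m) = refl
  recursive-term : (log1p ⊛ D⁺ (log1p ^S m)) n ≡ ℕ→ℚ m * (log1p ^S m) n
  recursive-term = begin
    (log1p ⊛ D⁺ (log1p ^S m)) n
      ≡⟨ sumBelow-cong (suc n) (λ i _ → cong (log1p i *_) (D⁺-log1p^S m (n ∸ i))) ⟩
    (log1p ⊛ (λ i → ℕ→ℚ m * (log1p ^S (m ∸ 1)) i)) n
      ≡⟨ ⊛-scaleʳ log1p (log1p ^S (m ∸ 1)) (ℕ→ℚ m) n ⟩
    ℕ→ℚ m * (log1p ⊛ (log1p ^S (m ∸ 1))) n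
      ≡⟨ m*log1p^S-pred m ⟩
    ℕ→ℚ m * (log1p ^S m) n
      ∎

log1p^S-coeff : ∀ n m → ℕ→ℚ (n !) * (log1p ^S m) n ≡ ℕ→ℚ (m !) * signedStirling1 n m
log1p^S-coeff zero    zero    = refl
log1p^S-coeff zero    (suc m) =
  trans (cong (λ z → ℕ→ℚ 1 * (0ℚ + z)) (ℚₚ.*-zeroˡ ((log1p ^S m) 0)))
        (sym (ℚₚ.*-zeroʳ (ℕ→ℚ (suc m !))))
log1p^S-coeff (suc n) zero    =
  trans (ℚₚ.*-zeroʳ (ℕ→ℚ (suc n !))) (sym (cong (ℕ→ℚ 1 *_) (signedStirling1-suc-zero n)))
log1p^S-coeff (suc n) (suc m) = begin
  ℕ→ℚ (suc n ℕ.* n !) * X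
    ≡⟨ cong (_* X) (ℕ→ℚ-* (suc n) (n !)) ⟩
  ℕ→ℚ (suc n) * A * X
    ≡⟨ solve 5 (λ a A X x Z → a :* A :* X := A :* (a :* X :+ x :* Z) :- x :* (A :* Z)) refl
         (ℕ→ℚ (suc n)) A X x Z ⟩
  A * (ℕ→ℚ (suc n) * X + x * Z) - x * (A * Z)
    ≡⟨ cong (λ w → A * w - x * (A * Z)) (D⁺-log1p^S (suc m) n) ⟩
  A * (c * Y) - x * (A * Z)
    ≡⟨ cong (_- x * (A * Z)) (x∙yz≈y∙xz A c Y) ⟩
  c * (A * Y) - x * (A * Z)
    ≡⟨ cong₂ (λ u v → c * u - x * v) (log1p^S-coeff n m) (log1p^S-coeff n (suc m)) ⟩
  c * (M * s n m) - x * (ℕ→ℚ (suc m ℕ.* m !) * s n (suc m))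
    ≡⟨ cong₂ (λ u v → c * (M * u) - x * (v * s n (suc m)))
         (sym (signedStirling1-rec n m)) (ℕ→ℚ-* (suc m) (m !)) ⟩
  c * (M * (x * s n (suc m) + s (suc n) (suc m))) - x * (c * M * s n (suc m))
    ≡⟨ solve 5 (λ c M x t u → c :* (M :* (x :* t :+ u)) :- x :* (c :* M :* t) := c :* M :* u) refl
         c M x (s n (suc m)) (s (suc n) (suc m)) ⟩
  c * M * s (suc n) (suc m)
    ≡⟨ cong (_* s (suc n) (suc m)) (sym (ℕ→ℚ-* (suc m) (m !))) ⟩
  ℕ→ℚ (suc m !) * s (suc n) (suc m)
    ∎
  where
  s = signedStirling1
  X = (log1p ^S suc m) (suc n)
  Y = (log1p ^S m) n
  Z = (log1p ^S suc m) n
  A = ℕ→ℚ (n !)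
  x = ℕ→ℚ n
  c = ℕ→ℚ (suc m)
  M = ℕ→ℚ (m !)

polyCauchy-signedStirling1 : ∀ j k →
  polyCauchy j k ≡ sumBelow (suc j) (λ m → invPow m k * signedStirling1 j m)
polyCauchy-signedStirling1 j k =
  trans (*-distribˡ-sumBelow (suc j) (ℕ→ℚ (j !)) _) (sumBelow-cong (suc j) (λ m _ → term m))
  where
  term : ∀ m → ℕ→ℚ (j !) * (lifCoeff k m * (log1p ^S m) j) ≡ invPow m k * signedStirling1 j m
  term m = begin
    F * (ι * a * P)    ≡⟨ solve 4 (λ F ι a P → F :* (ι :* a :* P) := ι :* a :* (F :* P)) refl F ι a P ⟩
    ι * a * (F * P)    ≡⟨ cong (ι * a *_) (log1p^S-coeff j m) ⟩
    ι * a * (M * σ)    ≡⟨ solve 4 (λ ι a M σ → ι :* a :* (M :* σ) := a :* σ :* (ι :* M)) refl ι a M σ ⟩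
    a * σ * (ι * M)    ≡⟨ cong (a * σ *_) (1/n*n≡1 (m !) {{m !≢0}}) ⟩
    a * σ * 1ℚ         ≡⟨ ℚₚ.*-identityʳ (a * σ) ⟩
    a * σ              ∎
    where
    F = ℕ→ℚ (j !)
    ι = _/_ (+ 1) (m !) {{m !≢0}}
    a = invPow m k
    P = (log1p ^S m) j
    M = ℕ→ℚ (m !)
    σ = signedStirling1 j m

≡ᵇ-refl : ∀ n → (n ≡ᵇ n) ≡ true
≡ᵇ-refl zero    = refl
≡ᵇ-refl (suc n) = ≡ᵇ-refl n

≢⇒≡ᵇ-false : ∀ {m n} → ¬ m ≡ n → (m ≡ᵇ n) ≡ false
≢⇒≡ᵇ-false {zero}  {zero}  m≢n = ⊥-elim (m≢n refl)
≢⇒≡ᵇ-false {zero}  {suc n} m≢n = refl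
≢⇒≡ᵇ-false {suc m} {zero}  m≢n = refl
≢⇒≡ᵇ-false {suc m} {suc n} m≢n = ≢⇒≡ᵇ-false (m≢n ∘′ cong suc)

≥⇒<ᵇ-false : ∀ {m n} → n ≤ m → (m <ᵇ n) ≡ false
≥⇒<ᵇ-false {m}     {zero}  _         = refl
≥⇒<ᵇ-false {suc m} {suc n} (s≤s n≤m) = ≥⇒<ᵇ-false n≤m

rStirling2⁺ : ℕ → ℕ → ℕ → ℕ
rStirling2⁺ r zero    j       = if j ≡ᵇ r then 1 else 0
rStirling2⁺ r (suc d) zero    = 0
rStirling2⁺ r (suc d) (suc j) = suc j ℕ.* rStirling2⁺ r d (suc j) ℕ.+ rStirling2⁺ r d j

r≤1+r+d : ∀ r d → r ≤ suc (r ℕ.+ d)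
r≤1+r+d r d = ℕₚ.m≤n⇒m≤1+n (ℕₚ.m≤m+n r d)

1+r+d≢r : ∀ r d → ¬ suc (r ℕ.+ d) ≡ r
1+r+d≢r r d = ℕₚ.>⇒≢ (s≤s (ℕₚ.m≤m+n r d))

rStirling2≡rStirling2⁺ : ∀ r d j → rStirling2 r (r ℕ.+ d) j ≡ rStirling2⁺ r d j
rStirling2≡rStirling2⁺ zero    zero    j = refl
rStirling2≡rStirling2⁺ (suc r) zero    j
  rewrite ℕₚ.+-identityʳ r | ≥⇒<ᵇ-false (ℕₚ.≤-refl {r}) | ≡ᵇ-refl r = refl
rStirling2≡rStirling2⁺ r       (suc d) zero
  rewrite ℕₚ.+-suc r d | ≥⇒<ᵇ-false (r≤1+r+d r d) | ≢⇒≡ᵇ-false (1+r+d≢r r d) = refl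
rStirling2≡rStirling2⁺ r       (suc d) (suc j)
  rewrite ℕₚ.+-suc r d | ≥⇒<ᵇ-false (r≤1+r+d r d) | ≢⇒≡ᵇ-false (1+r+d≢r r d)
        | rStirling2≡rStirling2⁺ r d (suc j) | rStirling2≡rStirling2⁺ r d j = refl

rStirling2⁺-below : ∀ {r j} d → j < r → rStirling2⁺ r d j ≡ 0
rStirling2⁺-below {r} {j}     zero    j<r rewrite ≢⇒≡ᵇ-false (ℕₚ.<⇒≢ j<r) = refl
rStirling2⁺-below {r} {zero}  (suc d) j<r = refl
rStirling2⁺-below {r} {suc j} (suc d) j<r
  rewrite rStirling2⁺-below d j<r | rStirling2⁺-below d (ℕₚ.<-trans (ℕₚ.n<1+n j) j<r) =
  trans (ℕₚ.+-identityʳ (j ℕ.* 0)) (ℕₚ.*-zeroʳ j)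

rStirling2⁺-above : ∀ {r j} d → r ℕ.+ d < j → rStirling2⁺ r d j ≡ 0
rStirling2⁺-above {r} {j}     zero    r+0<j
  rewrite ≢⇒≡ᵇ-false (ℕₚ.>⇒≢ (subst (_< j) (ℕₚ.+-identityʳ r) r+0<j)) = refl
rStirling2⁺-above {r} {zero}  (suc d) _ = refl
rStirling2⁺-above {r} {suc j} (suc d) r+1+d<1+j =
  vanish (ℕₚ.≤-pred (subst (_< suc j) (ℕₚ.+-suc r d) r+1+d<1+j))
  where
  vanish : r ℕ.+ d < j → rStirling2⁺ r (suc d) (suc j) ≡ 0
  vanish r+d<j rewrite rStirling2⁺-above d (ℕₚ.m<n⇒m<1+n r+d<j) | rStirling2⁺-above d r+d<j =
    trans (ℕₚ.+-identityʳ (j ℕ.* 0)) (ℕₚ.*-zeroʳ j)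

sum-rStirling2⁺-suc : ∀ r d (t : ℕ → ℚ) →
  sumBelow (suc (r ℕ.+ suc d)) (λ j → ℕ→ℚ (rStirling2⁺ r (suc d) j) * t j)
  ≡ sumBelow (suc (r ℕ.+ d)) (λ j → ℕ→ℚ (rStirling2⁺ r d j) * (ℕ→ℚ j * t j + t (suc j)))
sum-rStirling2⁺-suc r d t = begin
  sumBelow (suc (r ℕ.+ suc d)) g
    ≡⟨ cong (λ n → sumBelow (suc n) g) (ℕₚ.+-suc r d) ⟩
  sumBelow (suc N) g
    ≡⟨ sumBelow-sucˡ N g ⟩
  g 0 + sumBelow N (λ j → g (suc j))
    ≡⟨ cong (_+ sumBelow N (λ j → g (suc j))) (ℚₚ.*-zeroˡ (t 0)) ⟩
  0ℚ + sumBelow N (λ j → g (suc j))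
    ≡⟨ ℚₚ.+-identityˡ _ ⟩
  sumBelow N (λ j → g (suc j))
    ≡⟨ sumBelow-cong N (λ j _ → g-suc j) ⟩
  sumBelow N (λ j → h (suc j) + q j)
    ≡⟨ sumBelow-+ N _ _ ⟩
  sumBelow N (λ j → h (suc j)) + sumBelow N q
    ≡⟨ cong (_+ sumBelow N q) (sumBelow-shift N h (ℚₚ.*-zeroˡ (R 0 * t 0)) hN≡0) ⟩
  sumBelow N h + sumBelow N q
    ≡⟨ sym (sumBelow-+ N h q) ⟩
  sumBelow N (λ j → h j + q j)
    ≡⟨ sumBelow-cong N (λ j _ → solve 4 (λ x ρ a b → x :* (ρ :* a) :+ ρ :* b := ρ :* (x :* a :+ b)) refl
                                  (ℕ→ℚ j) (R j) (t j) (t (suc j))) ⟩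
  sumBelow N (λ j → R j * (ℕ→ℚ j * t j + t (suc j)))
    ∎
  where
  N = suc (r ℕ.+ d)
  R : ℕ → ℚ
  R j = ℕ→ℚ (rStirling2⁺ r d j)
  g h q : ℕ → ℚ
  g j = ℕ→ℚ (rStirling2⁺ r (suc d) j) * t j
  h j = ℕ→ℚ j * (R j * t j)
  q j = R j * t (suc j)
  g-suc : ∀ j → g (suc j) ≡ h (suc j) + q j
  g-suc j = begin
    ℕ→ℚ (suc j ℕ.* rStirling2⁺ r d (suc j) ℕ.+ rStirling2⁺ r d j) * t (suc j)
      ≡⟨ cong (_* t (suc j)) (trans (ℕ→ℚ-+ (suc j ℕ.* rStirling2⁺ r d (suc j)) (rStirling2⁺ r d j))
                                         (cong (_+ R j) (ℕ→ℚ-* (suc j) (rStirling2⁺ r d (suc j))))) ⟩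
    (ℕ→ℚ (suc j) * R (suc j) + R j) * t (suc j)
      ≡⟨ solve 4 (λ x ρ ρ′ a → (x :* ρ :+ ρ′) :* a := x :* (ρ :* a) :+ ρ′ :* a) refl
           (ℕ→ℚ (suc j)) (R (suc j)) (R j) (t (suc j)) ⟩
    h (suc j) + q j
      ∎
  hN≡0 : h N ≡ 0ℚ
  hN≡0 = begin
    ℕ→ℚ N * (R N * t N)     ≡⟨ cong (λ ρ → ℕ→ℚ N * (ℕ→ℚ ρ * t N)) (rStirling2⁺-above d ℕₚ.≤-refl) ⟩
    ℕ→ℚ N * (0ℚ * t N)      ≡⟨ cong (ℕ→ℚ N *_) (ℚₚ.*-zeroˡ (t N)) ⟩
    ℕ→ℚ N * 0ℚ              ≡⟨ ℚₚ.*-zeroʳ (ℕ→ℚ N) ⟩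
    0ℚ                      ∎

-- For m ≤ d the right-hand side is s(r, 0) (truncated subtraction), which vanishes only because r ≥ 1.
sum-rStirling2⁺-signedStirling1 : ∀ r d m →
  sumBelow (suc (suc r ℕ.+ d)) (λ j → ℕ→ℚ (rStirling2⁺ (suc r) d j) * signedStirling1 j m)
  ≡ signedStirling1 (suc r) (m ∸ d)
sum-rStirling2⁺-signedStirling1 r zero m = begin
  sumBelow (suc (suc r ℕ.+ 0)) f
    ≡⟨ cong (λ n → sumBelow (suc n) f) (ℕₚ.+-identityʳ (suc r)) ⟩
  sumBelow (suc r) f + f (suc r)
    ≡⟨ cong₂ _+_ (sumBelow-zero (suc r) below≡0) diagonal ⟩
  0ℚ + signedStirling1 (suc r) m
    ≡⟨ ℚₚ.+-identityˡ _ ⟩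
  signedStirling1 (suc r) m
    ∎
  where
  f : ℕ → ℚ
  f j = ℕ→ℚ (rStirling2⁺ (suc r) 0 j) * signedStirling1 j m
  below≡0 : ∀ j → j < suc r → f j ≡ 0ℚ
  below≡0 j j<r = trans (cong (λ ρ → ℕ→ℚ ρ * signedStirling1 j m) (rStirling2⁺-below 0 j<r))
                        (ℚₚ.*-zeroˡ (signedStirling1 j m))
  diagonal : f (suc r) ≡ signedStirling1 (suc r) m
  diagonal rewrite ≡ᵇ-refl r = ℚₚ.*-identityˡ (signedStirling1 (suc r) m)
sum-rStirling2⁺-signedStirling1 r (suc d) zero =
  trans (sum-rStirling2⁺-suc (suc r) d (λ j → signedStirling1 j 0))
    (trans (sumBelow-zero (suc (suc r ℕ.+ d)) (λ j _ →
              trans (cong (ℕ→ℚ (rStirling2⁺ (suc r) d j) *_) (signedStirling1-rec-zero j))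
                    (ℚₚ.*-zeroʳ (ℕ→ℚ (rStirling2⁺ (suc r) d j)))))
           (sym (signedStirling1-suc-zero r)))
sum-rStirling2⁺-signedStirling1 r (suc d) (suc m) =
  trans (sum-rStirling2⁺-suc (suc r) d (λ j → signedStirling1 j (suc m)))
    (trans (sumBelow-cong (suc (suc r ℕ.+ d)) (λ j _ →
              cong (ℕ→ℚ (rStirling2⁺ (suc r) d j) *_) (signedStirling1-rec j m)))
           (sum-rStirling2⁺-signedStirling1 r d m))

sum-rStirling2⁺-polyCauchy : ∀ r d k →
  sumBelow (suc (suc r ℕ.+ d)) (λ j → ℕ→ℚ (rStirling2⁺ (suc r) d j) * polyCauchy j k)
  ≡ sumBelow (suc (suc r ℕ.+ d)) (λ m → invPow m k * signedStirling1 (suc r) (m ∸ d))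
sum-rStirling2⁺-polyCauchy r d k = begin
  sumBelow N (λ j → R j * polyCauchy j k)
    ≡⟨ sumBelow-cong N (λ j j<N → cong (R j *_) (polyCauchy-up-to-N j j<N)) ⟩
  sumBelow N (λ j → R j * sumBelow N (λ m → invPow m k * signedStirling1 j m))
    ≡⟨ sumBelow-interchange N N R (λ m → invPow m k) signedStirling1 ⟩
  sumBelow N (λ m → invPow m k * sumBelow N (λ j → R j * signedStirling1 j m))
    ≡⟨ sumBelow-cong N (λ m _ → cong (invPow m k *_) (sum-rStirling2⁺-signedStirling1 r d m)) ⟩
  sumBelow N (λ m → invPow m k * signedStirling1 (suc r) (m ∸ d))
    ∎
  where
  N = suc (suc r ℕ.+ d)
  R : ℕ → ℚ
  R j = ℕ→ℚ (rStirling2⁺ (suc r) d j)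
  polyCauchy-up-to-N : ∀ j → j < N → polyCauchy j k ≡ sumBelow N (λ m → invPow m k * signedStirling1 j m)
  polyCauchy-up-to-N j j<N =
    trans (polyCauchy-signedStirling1 j k)
          (sumBelow-extend _ j<N (λ m j<m →
             trans (cong (invPow m k *_) (signedStirling1-vanish j<m)) (ℚₚ.*-zeroʳ (invPow m k))))

sum-signedStirling1-reindex : ∀ r d (a : ℕ → ℚ) →
  sumBelow (suc (suc r ℕ.+ d)) (λ m → a m * signedStirling1 (suc r) (m ∸ d))
  ≡ sumFromTo 1 (suc r) (λ ℓ → (- 1ℚ) ^ℚ (suc r ∸ ℓ) * a (d ℕ.+ ℓ) * ℕ→ℚ (stirling1 (suc r) ℓ))
sum-signedStirling1-reindex r d a = begin
  sumBelow (suc (suc r ℕ.+ d)) g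
    ≡⟨ cong (λ t → sumBelow (suc t) g) (ℕₚ.+-comm (suc r) d) ⟩
  sumBelow (suc d ℕ.+ suc r) g
    ≡⟨ sumBelow-drop-zero-prefix (suc d) (suc r) g-below≡0 ⟩
  sumBelow (suc r) (λ i → g (suc d ℕ.+ i))
    ≡⟨ sumBelow-cong (suc r) (λ i _ → g-term i) ⟩
  sumBelow (suc r) (λ i → (- 1ℚ) ^ℚ (r ∸ i) * a (d ℕ.+ suc i) * ℕ→ℚ (stirling1 (suc r) (suc i)))
    ∎
  where
  g : ℕ → ℚ
  g m = a m * signedStirling1 (suc r) (m ∸ d)
  g-below≡0 : ∀ m → m < suc d → g m ≡ 0ℚ
  g-below≡0 m (s≤s m≤d) =
    trans (cong (λ e → a m * signedStirling1 (suc r) e) (ℕₚ.m≤n⇒m∸n≡0 m≤d))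
          (trans (cong (a m *_) (signedStirling1-suc-zero r)) (ℚₚ.*-zeroʳ (a m)))
  g-term : ∀ i → g (suc d ℕ.+ i) ≡ (- 1ℚ) ^ℚ (r ∸ i) * a (d ℕ.+ suc i) * ℕ→ℚ (stirling1 (suc r) (suc i))
  g-term i = begin
    a (suc d ℕ.+ i) * signedStirling1 (suc r) (suc d ℕ.+ i ∸ d)
      ≡⟨ cong₂ (λ m e → a m * signedStirling1 (suc r) e)
           (sym (ℕₚ.+-suc d i))
           (trans (cong (_∸ d) (sym (ℕₚ.+-suc d i))) (ℕₚ.m+n∸m≡n d (suc i))) ⟩
    a (d ℕ.+ suc i) * ((- 1ℚ) ^ℚ (r ∸ i) * ℕ→ℚ (stirling1 (suc r) (suc i)))
      ≡⟨ solve 3 (λ α ε σ → α :* (ε :* σ) := ε :* α :* σ) refl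
           (a (d ℕ.+ suc i)) ((- 1ℚ) ^ℚ (r ∸ i)) (ℕ→ℚ (stirling1 (suc r) (suc i))) ⟩
    (- 1ℚ) ^ℚ (r ∸ i) * a (d ℕ.+ suc i) * ℕ→ℚ (stirling1 (suc r) (suc i))
      ∎

theorem1 : (n r : ℕ) (k : ℤ) → 1 ≤ r → r ≤ n →
    sumFromTo r n (λ j → ℕ→ℚ (rStirling2 r n j) * polyCauchy j k)
      ≡ sumFromTo 1 r (λ ℓ → ((- 1ℚ) ^ℚ (r ∸ ℓ)) * invPow (n ∸ r ℕ.+ ℓ) k * ℕ→ℚ (stirling1 r ℓ))
theorem1 n (suc r) k (s≤s z≤n) r≤n with n ∸ suc r | ℕₚ.m+[n∸m]≡n r≤n
... | d | refl = begin
  sumFromTo (suc r) n f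
    ≡⟨ sumFromTo-vanishing-below f (ℕₚ.m≤n⇒m≤1+n r≤n) f-below≡0 ⟩
  sumBelow (suc n) f
    ≡⟨ sumBelow-cong (suc n) (λ j _ → cong (λ ρ → ℕ→ℚ ρ * polyCauchy j k) (rStirling2≡rStirling2⁺ (suc r) d j)) ⟩
  sumBelow (suc n) (λ j → ℕ→ℚ (rStirling2⁺ (suc r) d j) * polyCauchy j k)
    ≡⟨ sum-rStirling2⁺-polyCauchy r d k ⟩
  sumBelow (suc n) (λ m → invPow m k * signedStirling1 (suc r) (m ∸ d))
    ≡⟨ sum-signedStirling1-reindex r d (λ m → invPow m k) ⟩
  sumFromTo 1 (suc r) (λ ℓ → ((- 1ℚ) ^ℚ (suc r ∸ ℓ)) * invPow (d ℕ.+ ℓ) k * ℕ→ℚ (stirling1 (suc r) ℓ))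
    ∎
  where
  f : ℕ → ℚ
  f j = ℕ→ℚ (rStirling2 (suc r) n j) * polyCauchy j k
  f-below≡0 : ∀ j → j < suc r → f j ≡ 0ℚ
  f-below≡0 j j<r =
    trans (cong (λ ρ → ℕ→ℚ ρ * polyCauchy j k)
                (trans (rStirling2≡rStirling2⁺ (suc r) d j) (rStirling2⁺-below d j<r)))
          (ℚₚ.*-zeroˡ (polyCauchy j k))
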